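{- Let $M=(E,\rho)$ be a binary simple $(n,k,d)$-matroid with no isthmuses and $k=4$. If $\mathcal{Z}(M)$ has height 3, then $n\leq 8$, or equivalently, $\eta(E)\leq 4$.
   Context: A matroid is binary if representable over $\mathbb{F}_2$; simple means no loops and no parallel elements; an isthmus is an element $e$ with $\rho(E-e)<\rho(E)$. $\eta(X)=|X|-\rho(X)$. An $(n,k,d)$-matroid has $|E|=n$, $\rho(E)=k$ and minimum distance $d=\min\{|X|:X\subseteq E,\ \rho(E-X)<\rho(E)\}$. $\mathcal{Z}(M)$ is the lattice (under inclusion) of cyclic flats, i.e. sets $X$ with $\mathrm{cl}(X)=X$ and $\mathrm{cyc}(X)=X$, where $\mathrm{cl}(X)=\{e:\rho(X\cup e)=\rho(X)\}$ and $\mathrm{cyc}(X)=\{e\in X:\rho(X-e)=\rho(X)\}$. "Height 3" means the longest chains in $\mathcal{Z}(M)$ consist of three elements $0_{\mathcal{Z}}\subsetneq Z\subsetneq 1_{\mathcal{Z}}$. -}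

module Defs where

open import Data.Nat using (ℕ; _≤_; _<_)
open import Data.Bool using (Bool; true; false; if_then_else_; _xor_)
open import Data.Vec using (Vec; []; _∷_; replicate; zipWith)
open import Data.Fin using (Fin; zero; suc)
open import Data.Fin.Subset using (Subset; _∈_; _⊆_; _⊂_; _∪_; _∩_; _-_; ⁅_⁆; ∁; ⊤; ∣_∣; Nonempty)
open import Data.Product using (Σ; _×_; ∃)
open import Relation.Binary.PropositionalEquality using (_≡_; _≢_)
open import Relation.Nullary using (¬_)
import Data.Empty
import Data.Nat

record Matroid (n : ℕ) : Set where
  field
    ρ          : Subset n → ℕ
    bounded    : ∀ X → ρ X ≤ ∣ X ∣
    monotone   : ∀ X Y → X ⊆ Y → ρ X ≤ ρ Y
    submodular : ∀ X Y → ρ (X ∪ Y) Data.Nat.+ ρ (X ∩ Y) ≤ ρ X Data.Nat.+ ρ Y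

open Matroid public

colSum : ∀ {n m} → (Fin n → Vec Bool m) → Subset n → Vec Bool m
colSum {Data.Nat.zero} {m} A [] = replicate m false
colSum {Data.Nat.suc n} A (s ∷ Z) =
  if s then zipWith _xor_ (A zero) (colSum (λ i → A (suc i)) Z)
       else colSum (λ i → A (suc i)) Z

LinIndep : ∀ {n m} → (Fin n → Vec Bool m) → Subset n → Set
LinIndep {n} {m} A Y = ∀ Z → Z ⊆ Y → Nonempty Z → colSum A Z ≢ replicate m false

IsF₂Rank : ∀ {n m} → (Fin n → Vec Bool m) → Subset n → ℕ → Set
IsF₂Rank A X r =
  (Σ _ λ Y → Y ⊆ X × LinIndep A Y × ∣ Y ∣ ≡ r) ×
  (∀ Y → Y ⊆ X → LinIndep A Y → ∣ Y ∣ ≤ r)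

Binary : ∀ {n} → Matroid n → Set
Binary {n} M = Σ ℕ λ m → Σ (Fin n → Vec Bool m) λ A → ∀ X → IsF₂Rank A X (ρ M X)

Loop : ∀ {n} → Matroid n → Fin n → Set
Loop M e = ρ M ⁅ e ⁆ ≡ 0

Parallel : ∀ {n} → Matroid n → Fin n → Fin n → Set
Parallel M e f = e ≢ f × ¬ Loop M e × ¬ Loop M f × ρ M (⁅ e ⁆ ∪ ⁅ f ⁆) ≡ 1

Simple : ∀ {n} → Matroid n → Set
Simple M = (∀ e → ¬ Loop M e) × (∀ e f → ¬ Parallel M e f)

Isthmus : ∀ {n} → Matroid n → Fin n → Set
Isthmus M e = ρ M (⊤ - e) < ρ M ⊤

Closed : ∀ {n} → Matroid n → Subset n → Set
Closed M X = ∀ e → ρ M (X ∪ ⁅ e ⁆) ≡ ρ M X → e ∈ X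

Cyclic : ∀ {n} → Matroid n → Subset n → Set
Cyclic M X = ∀ e → e ∈ X → ρ M (X - e) ≡ ρ M X

CyclicFlat : ∀ {n} → Matroid n → Subset n → Set
CyclicFlat M X = Closed M X × Cyclic M X

-- Height 3 of Z(M): the longest chains of cyclic flats (under strict inclusion)
-- have exactly three elements: a 3-element chain exists and no 4-element chain exists.
Height3 : ∀ {n} → Matroid n → Set
Height3 {n} M =
  (Σ (Subset n) λ Z₀ → Σ (Subset n) λ Z₁ → Σ (Subset n) λ Z₂ →
     CyclicFlat M Z₀ × CyclicFlat M Z₁ × CyclicFlat M Z₂ × Z₀ ⊂ Z₁ × Z₁ ⊂ Z₂) ×
  (∀ Z₀ Z₁ Z₂ Z₃ → CyclicFlat M Z₀ → CyclicFlat M Z₁ → CyclicFlat M Z₂ → CyclicFlat M Z₃ →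
     Z₀ ⊂ Z₁ → Z₁ ⊂ Z₂ → Z₂ ⊂ Z₃ → Data.Empty.⊥)

module Submission where

-- A simple binary matroid of rank 4 is a set of n points of PG(3,2), i.e. of nonzero vectors
-- of F₂⁴.  Suppose n ≥ 9.  Projecting from any point x onto F₂³ makes two points collide, and
-- their sum is x: there is a line {p, q, w}.  Projecting further from that line onto F₂², two
-- of the at least 6 points off the line, u and v, fall into the same one of the 3 nonzero
-- classes, so u + v is a point s of the line.  The triangles T₁ = {p, q, w} and T₂ = {u, v, s}
-- are cyclic, hence so are cl T₁ and cl (T₁ ∪ T₂); these have ranks 2 and 3 (u is off the
-- line, and submodularity at the common point s).  Together with ∅ and E, which are cyclic
-- flats as there are no loops and no isthmuses, they form a chain of four cyclic flats,
-- contradicting height 3.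

open import Defs
open import Data.Nat using (ℕ; _≤_)
open import Data.Fin using (Fin)
open import Data.Fin.Subset using (⊤)
open import Relation.Binary.PropositionalEquality using (_≡_)
open import Relation.Nullary using (¬_)

open import Data.Bool using (Bool; true; false; _xor_)
open import Data.Bool.Properties
  using (xor-comm; xor-assoc; xor-identityˡ; xor-identityʳ; xor-same) renaming (_≟_ to _≟ᵇ_)
open import Data.Empty using (⊥-elim)
open import Data.Fin as Fin using (combine; join; splitAt)
open import Data.Fin.Properties using (2↔Bool; combine-injective; splitAt-join; pigeonhole; <⇒≢; any?)
open import Data.Fin.Subset as Subset
  using (Subset; Nonempty; _∈_; _∉_; _⊆_; _⊂_; _∪_; _∩_; _─_; _-_; ⁅_⁆; ∣_∣)
open import Data.Fin.Subset.Properties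
  using ( _∈?_; _⊆?_; anySubset?; nonempty?; Empty-unique; ⊆-antisym; ⊥⊆; ⊆⊤; ∉⊥; ∈⊤
        ; x∈⁅x⁆; x∈⁅y⁆⇒x≡y; x∉⁅y⁆⇒x≢y; x∈p∪q⁺; x∈p∪q⁻; x∈p∩q⁺; p⊆p∪q; q⊆p∪q
        ; ∪-identityˡ; ∪-identityʳ; ∪-assoc; p─q⊆p; p─⊥≡p; x∈p∧x≢y⇒x∈p-y; x∈p⇒p-x⊂p
        ; drop-∷-⊆; ∣⊥∣≡0; ∣⁅x⁆∣≡1; ∣p∣≤∣x∷p∣; p⊂q⇒∣p∣<∣q∣ )
open import Data.Fin.Subset.Induction using (⊂-wellFounded; Acc; acc)
open import Data.List using (List; []; _∷_; foldr; length; lookup)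
open import Data.List.Membership.Propositional using () renaming (_∈_ to _∈ₗ_; _∉_ to _∉ₗ_)
open import Data.List.Relation.Unary.All using ([]; _∷_)
open import Data.List.Relation.Unary.All.Properties using (All¬⇒¬Any)
open import Data.List.Relation.Unary.Any using (here; there; index) renaming (any? to anyₗ?)
open import Data.List.Relation.Unary.Any.Properties using (lookup-index)
open import Data.List.Relation.Unary.Unique.Propositional using (Unique; []; _∷_)
open import Data.Nat as ℕ using (zero; suc; _<_; _+_; _^_; s≤s; z≤n)
open import Data.Nat.Properties
  using ( ≤-refl; ≤-reflexive; ≤-trans; ≤-antisym; ≤-<-trans; ≤-pred; n≤1+n; n≤0⇒n≡0
        ; <-irrefl; <⇒≱; ≰⇒>; ≮⇒≥; ≤∧≢⇒<; n≢0⇒n>0; +-mono-≤; +-monoʳ-≤; +-cancelʳ-≤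
        ; module ≤-Reasoning )
open import Data.Product using (Σ; ∃; ∃₂; _×_; _,_; proj₁; proj₂)
open import Data.Sum using (_⊎_; inj₁; inj₂; [_,_]′)
open import Data.Sum.Properties using (inj₁-injective; inj₂-injective)
import Data.Vec as Vec
open import Data.Vec using (Vec; []; _∷_; replicate; zipWith; tabulate)
open import Data.Vec.Properties
  using ( zipWith-comm; zipWith-assoc; zipWith-identityˡ; zipWith-identityʳ; ∷-injective
        ; ≡-dec; lookup∘tabulate; lookup⇒[]=; []=⇒lookup )
open import Function using (_∘_; id; Inverse)
open import Function.Definitions using (Injective)
open import Relation.Binary.PropositionalEquality
  using (_≢_; ≢-sym; refl; sym; trans; cong; cong₂; subst; subst₂; module ≡-Reasoning)
open import Relation.Nullary using (Dec; yes; no; does)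
open import Relation.Nullary.Decidable using (dec-true; _×-dec_; ¬?)
open import Relation.Unary using (Decidable)

private variable k m n : ℕ

-- Vectors over F₂

0ᵥ : Vec Bool k
0ᵥ = replicate _ false

infixl 6 _⊕_
_⊕_ : Vec Bool k → Vec Bool k → Vec Bool k
_⊕_ = zipWith _xor_

infixr 7 _·_
_·_ : Bool → Vec Bool k → Vec Bool k
true  · x = x
false · x = 0ᵥ

⊕-comm : (x y : Vec Bool k) → x ⊕ y ≡ y ⊕ x
⊕-comm = zipWith-comm xor-comm

⊕-assoc : (x y z : Vec Bool k) → (x ⊕ y) ⊕ z ≡ x ⊕ (y ⊕ z)
⊕-assoc = zipWith-assoc xor-assoc

⊕-identityˡ : (x : Vec Bool k) → 0ᵥ ⊕ x ≡ x
⊕-identityˡ = zipWith-identityˡ xor-identityˡ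

⊕-identityʳ : (x : Vec Bool k) → x ⊕ 0ᵥ ≡ x
⊕-identityʳ = zipWith-identityʳ xor-identityʳ

⊕-self : (x : Vec Bool k) → x ⊕ x ≡ 0ᵥ
⊕-self []      = refl
⊕-self (a ∷ x) = cong₂ _∷_ (xor-same a) (⊕-self x)

⊕-cancelˡ : (x y : Vec Bool k) → x ⊕ (x ⊕ y) ≡ y
⊕-cancelˡ x y = begin
  x ⊕ (x ⊕ y) ≡⟨ sym (⊕-assoc x x y) ⟩
  (x ⊕ x) ⊕ y ≡⟨ cong (_⊕ y) (⊕-self x) ⟩
  0ᵥ ⊕ y      ≡⟨ ⊕-identityˡ y ⟩
  y           ∎
  where open ≡-Reasoning

⊕-cancelʳ : (x y : Vec Bool k) → (x ⊕ y) ⊕ y ≡ x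
⊕-cancelʳ x y = begin
  (x ⊕ y) ⊕ y ≡⟨ ⊕-assoc x y y ⟩
  x ⊕ (y ⊕ y) ≡⟨ cong (x ⊕_) (⊕-self y) ⟩
  x ⊕ 0ᵥ      ≡⟨ ⊕-identityʳ x ⟩
  x           ∎
  where open ≡-Reasoning

⊕≡⇒≡⊕ : {x y z : Vec Bool k} → x ⊕ y ≡ z → x ≡ z ⊕ y
⊕≡⇒≡⊕ {x = x} {y} refl = sym (⊕-cancelʳ x y)

⊕≡0⇒≡ : {x y : Vec Bool k} → x ⊕ y ≡ 0ᵥ → x ≡ y
⊕≡0⇒≡ {y = y} x⊕y≡0 = trans (⊕≡⇒≡⊕ x⊕y≡0) (⊕-identityˡ y)

⊕-swap : (a b c : Vec Bool k) → a ⊕ (b ⊕ c) ≡ b ⊕ (a ⊕ c)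
⊕-swap a b c = begin
  a ⊕ (b ⊕ c) ≡⟨ sym (⊕-assoc a b c) ⟩
  (a ⊕ b) ⊕ c ≡⟨ cong (_⊕ c) (⊕-comm a b) ⟩
  (b ⊕ a) ⊕ c ≡⟨ ⊕-assoc b a c ⟩
  b ⊕ (a ⊕ c) ∎
  where open ≡-Reasoning

⊕-interchange : (a b c d : Vec Bool k) → (a ⊕ b) ⊕ (c ⊕ d) ≡ (a ⊕ c) ⊕ (b ⊕ d)
⊕-interchange a b c d = begin
  (a ⊕ b) ⊕ (c ⊕ d) ≡⟨ ⊕-assoc a b (c ⊕ d) ⟩
  a ⊕ (b ⊕ (c ⊕ d)) ≡⟨ cong (a ⊕_) (⊕-swap b c d) ⟩
  a ⊕ (c ⊕ (b ⊕ d)) ≡⟨ sym (⊕-assoc a c (b ⊕ d)) ⟩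
  (a ⊕ c) ⊕ (b ⊕ d) ∎
  where open ≡-Reasoning

·-distrib-xor : ∀ a b (x : Vec Bool k) → (a xor b) · x ≡ a · x ⊕ b · x
·-distrib-xor true  true  x = sym (⊕-self x)
·-distrib-xor true  false x = sym (⊕-identityʳ x)
·-distrib-xor false b     x = sym (⊕-identityˡ (b · x))

-- The linear map F₂^(k+1) → F₂^k eliminating the first coordinate in which t is nonzero.
project : Vec Bool (suc k) → Vec Bool (suc k) → Vec Bool k
project             (true  ∷ t) (a ∷ x) = x ⊕ a · t
project {k = zero}  (false ∷ t) (a ∷ x) = []
project {k = suc k} (false ∷ t) (a ∷ x) = a ∷ project t x

project-⊕ : (t x y : Vec Bool (suc k)) → project t (x ⊕ y) ≡ project t x ⊕ project t y
project-⊕             (true  ∷ t) (a ∷ x) (b ∷ y) = begin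
  (x ⊕ y) ⊕ (a xor b) · t   ≡⟨ cong ((x ⊕ y) ⊕_) (·-distrib-xor a b t) ⟩
  (x ⊕ y) ⊕ (a · t ⊕ b · t) ≡⟨ ⊕-interchange x y (a · t) (b · t) ⟩
  (x ⊕ a · t) ⊕ (y ⊕ b · t) ∎
  where open ≡-Reasoning
project-⊕ {k = zero}  (false ∷ t) (a ∷ x) (b ∷ y) = refl
project-⊕ {k = suc k} (false ∷ t) (a ∷ x) (b ∷ y) = cong ((a xor b) ∷_) (project-⊕ t x y)

project-kernel : {t z : Vec Bool (suc k)} → t ≢ 0ᵥ → project t z ≡ 0ᵥ → z ≡ 0ᵥ ⊎ z ≡ t
project-kernel {t = true ∷ t} {false ∷ z} _ eq = inj₁ (cong (false ∷_) (trans (sym (⊕-identityʳ z)) eq))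
project-kernel {t = true ∷ t} {true  ∷ z} _ eq = inj₂ (cong (true ∷_) (⊕≡0⇒≡ eq))
project-kernel {k = zero}  {false ∷ []} t≢0 _ = ⊥-elim (t≢0 refl)
project-kernel {k = suc k} {false ∷ t} {a ∷ z} t≢0 eq with ∷-injective eq
... | refl , eq′ with project-kernel (t≢0 ∘ cong (false ∷_)) eq′
...   | inj₁ z≡0 = inj₁ (cong (false ∷_) z≡0)
...   | inj₂ z≡t = inj₂ (cong (false ∷_) z≡t)

project-fibre : {t x y : Vec Bool (suc k)} → t ≢ 0ᵥ → project t x ≡ project t y → x ≡ y ⊎ x ⊕ y ≡ t
project-fibre {t = t} {x} {y} t≢0 eq with project-kernel t≢0 (begin
  project t (x ⊕ y)           ≡⟨ project-⊕ t x y ⟩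
  project t x ⊕ project t y   ≡⟨ cong (_⊕ project t y) eq ⟩
  project t y ⊕ project t y   ≡⟨ ⊕-self (project t y) ⟩
  0ᵥ                          ∎)
  where open ≡-Reasoning
... | inj₁ x⊕y≡0 = inj₁ (⊕≡0⇒≡ x⊕y≡0)
... | inj₂ x⊕y≡t = inj₂ x⊕y≡t

bit : Bool → Fin 2
bit = Inverse.from 2↔Bool

bit-injective : Injective _≡_ _≡_ bit
bit-injective {a} {b} eq = begin
  a                          ≡⟨ sym (Inverse.strictlyInverseˡ 2↔Bool a) ⟩
  Inverse.to 2↔Bool (bit a)  ≡⟨ cong (Inverse.to 2↔Bool) eq ⟩
  Inverse.to 2↔Bool (bit b)  ≡⟨ Inverse.strictlyInverseˡ 2↔Bool b ⟩
  b                          ∎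
  where open ≡-Reasoning

encode : Vec Bool k → Fin (2 ^ k)
encode []      = Fin.zero
encode (b ∷ x) = combine (bit b) (encode x)

encode-injective : Injective _≡_ _≡_ (encode {k})
encode-injective {x = []}    {[]}    _  = refl
encode-injective {x = a ∷ x} {b ∷ y} eq with combine-injective _ _ _ _ eq
... | a≡b , x≡y = cong₂ _∷_ (bit-injective a≡b) (encode-injective x≡y)

join-injective : ∀ {a b} → Injective _≡_ _≡_ (join a b)
join-injective {a} {b} {x} {y} eq = begin
  x                       ≡⟨ sym (splitAt-join a b x) ⟩
  splitAt a (join a b x)  ≡⟨ cong (splitAt a) eq ⟩
  splitAt a (join a b y)  ≡⟨ splitAt-join a b y ⟩
  y                       ∎
  where open ≡-Reasoning

-- Points of a binary projective space

record PointSet (n d : ℕ) : Set where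
  field
    point           : Fin n → Vec Bool d
    point-injective : Injective _≡_ _≡_ point
    point-nonzero   : ∀ e → point e ≢ 0ᵥ

record MeetingLines {n d} (P : Fin n → Vec Bool d) : Set where
  field
    p q w u v s : Fin n
    line₁       : P p ⊕ P q ≡ P w
    line₂       : P u ⊕ P v ≡ P s
    s∈line₁     : s ∈ₗ p ∷ q ∷ w ∷ []
    u∉line₁     : u ∉ₗ p ∷ q ∷ w ∷ []

MeetingLines-map : {d : ℕ} {P : Fin n → Vec Bool d} {Q : Fin n → Vec Bool m}
                   (f : Vec Bool d → Vec Bool m) → (∀ x y → f (x ⊕ y) ≡ f x ⊕ f y) →
                   (∀ e → f (P e) ≡ Q e) → MeetingLines P → MeetingLines Q
MeetingLines-map {P = P} {Q} f f-⊕ f∘P≡Q L = record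
  { p = p; q = q; w = w; u = u; v = v; s = s
  ; line₁ = map-line line₁; line₂ = map-line line₂; s∈line₁ = s∈line₁; u∉line₁ = u∉line₁ }
  where
  open MeetingLines L
  map-line : ∀ {a b c} → P a ⊕ P b ≡ P c → Q a ⊕ Q b ≡ Q c
  map-line {a} {b} {c} line = begin
    Q a ⊕ Q b          ≡⟨ sym (cong₂ _⊕_ (f∘P≡Q a) (f∘P≡Q b)) ⟩
    f (P a) ⊕ f (P b)  ≡⟨ sym (f-⊕ (P a) (P b)) ⟩
    f (P a ⊕ P b)      ≡⟨ cong f line ⟩
    f (P c)            ≡⟨ f∘P≡Q c ⟩
    Q c                ∎
    where open ≡-Reasoning

module _ {d} (S : PointSet n d) where
  open PointSet S

  line-distinct : ∀ {a b c} → point a ⊕ point b ≡ point c → a ≢ b × a ≢ c × b ≢ c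
  line-distinct {a} {b} {c} line = a≢b , a≢c , b≢c
    where
    a≢b : a ≢ b
    a≢b refl = point-nonzero c (trans (sym line) (⊕-self (point a)))
    a≢c : a ≢ c
    a≢c refl = point-nonzero b (trans (⊕≡⇒≡⊕ (trans (⊕-comm (point b) (point a)) line)) (⊕-self (point a)))
    b≢c : b ≢ c
    b≢c refl = point-nonzero a (trans (⊕≡⇒≡⊕ line) (⊕-self (point b)))

module _ (S : PointSet n (suc k)) where
  open PointSet S

  collision : ∀ {t u v} → t ≢ 0ᵥ → u ≢ v → project t (point u) ≡ project t (point v) →
              point u ⊕ point v ≡ t
  collision t≢0 u≢v eq with project-fibre t≢0 eq
  ... | inj₁ same = ⊥-elim (u≢v (point-injective same))
  ... | inj₂ sum  = sum

  line-through : 2 ^ k < n → ∀ x → ∃₂ λ u v → u ≢ v × point u ⊕ point v ≡ point x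
  line-through big x with pigeonhole big (encode ∘ project (point x) ∘ point)
  ... | u , v , u<v , eq = u , v , <⇒≢ u<v , collision (point-nonzero x) (<⇒≢ u<v) (encode-injective eq)

module _ (S : PointSet n (suc (suc k))) {p q w}
         (line : PointSet.point S p ⊕ PointSet.point S q ≡ PointSet.point S w) where
  open PointSet S

  private
    ℓ : List (Fin n)
    ℓ = p ∷ q ∷ w ∷ []

    t : Vec Bool (suc (suc k))
    t = point w

    t′ : Vec Bool (suc k)
    t′ = project t (point p)

    t′≢0 : t′ ≢ 0ᵥ
    t′≢0 t′≡0 with project-kernel (point-nonzero w) t′≡0
    ... | inj₁ p≡0 = point-nonzero p p≡0
    ... | inj₂ p≡w = proj₁ (proj₂ (line-distinct S line)) (point-injective p≡w)

    project-line : Fin n → Vec Bool k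
    project-line e = project t′ (project t (point e))

    -- The points of the line get labels of their own, so that a collision of labels
    -- can only happen between two points off the line.
    label : Fin n → Fin 3 ⊎ Fin (2 ^ k)
    label e with anyₗ? (e Fin.≟_) ℓ
    ... | yes e∈ℓ = inj₁ (index e∈ℓ)
    ... | no  _   = inj₂ (encode (project-line e))

    meeting : ∀ {u v} → u ∉ₗ ℓ → ∀ x → point u ⊕ point v ≡ point x → x ∈ₗ ℓ → MeetingLines point
    meeting {u} {v} u∉ℓ x uvx x∈ℓ = record
      { p = p; q = q; w = w; u = u; v = v; s = x
      ; line₁ = line; line₂ = uvx; s∈line₁ = x∈ℓ; u∉line₁ = u∉ℓ }

    off-line-collision : ∀ {u v} → u ∉ₗ ℓ → u ≢ v → project-line u ≡ project-line v → MeetingLines point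
    off-line-collision {u} {v} u∉ℓ u≢v eq with project-fibre t′≢0 eq
    ... | inj₁ same = meeting u∉ℓ w (collision S (point-nonzero w) u≢v same) (there (there (here refl)))
    ... | inj₂ sum with project-fibre (point-nonzero w) (trans (project-⊕ t (point u) (point v)) sum)
    ...   | inj₁ uvp  = meeting u∉ℓ p uvp (here refl)
    ...   | inj₂ uvpw = meeting u∉ℓ q (trans (⊕≡⇒≡⊕ uvpw) wp≡q) (there (here refl))
      where
      wp≡q : point w ⊕ point p ≡ point q
      wp≡q = sym (⊕≡⇒≡⊕ (trans (⊕-comm (point q) (point p)) line))

    labels-collide : ∀ {u v} → u ≢ v → label u ≡ label v → MeetingLines point
    labels-collide {u} {v} u≢v eq with anyₗ? (u Fin.≟_) ℓ | anyₗ? (v Fin.≟_) ℓ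
    ... | yes u∈ℓ | yes v∈ℓ =
      ⊥-elim (u≢v (trans (lookup-index u∈ℓ)
                  (trans (cong (lookup ℓ) (inj₁-injective eq)) (sym (lookup-index v∈ℓ)))))
    ... | no  u∉ℓ | no  _   = off-line-collision u∉ℓ u≢v (encode-injective (inj₂-injective eq))
    labels-collide _ () | yes _ | no _
    labels-collide _ () | no _  | yes _

  line-meeting : 3 + 2 ^ k < n → MeetingLines point
  line-meeting big with pigeonhole big (join 3 (2 ^ k) ∘ label)
  ... | u , v , u<v , eq = labels-collide (<⇒≢ u<v) (join-injective eq)

meeting-lines : (S : PointSet n (suc (suc k))) → 2 ^ suc k < n → 3 + 2 ^ k < n →
                MeetingLines (PointSet.point S)
meeting-lines S big₁ big₂ with line-through S big₁ (Fin.fromℕ< (≤-<-trans z≤n big₁))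
... | p , q , _ , line = line-meeting S line big₂

-- Finite subsets

⁅x⁆⊆p : {p : Subset n} {x : Fin n} → x ∈ p → ⁅ x ⁆ ⊆ p
⁅x⁆⊆p {p = p} {x} x∈p y∈⁅x⁆ = subst (_∈ p) (sym (x∈⁅y⁆⇒x≡y x y∈⁅x⁆)) x∈p

∪-⊆ : {p q r : Subset n} → p ⊆ r → q ⊆ r → p ∪ q ⊆ r
∪-⊆ {p = p} {q} p⊆r q⊆r x∈p∪q = [ p⊆r , q⊆r ]′ (x∈p∪q⁻ p q x∈p∪q)

∪-monoˡ-⊆ : {p q r : Subset n} → p ⊆ q → p ∪ r ⊆ q ∪ r
∪-monoˡ-⊆ {q = q} {r} p⊆q = ∪-⊆ (p⊆p∪q r ∘ p⊆q) (q⊆p∪q q r)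

∪-monoʳ-⊆ : {p q r : Subset n} → p ⊆ q → r ∪ p ⊆ r ∪ q
∪-monoʳ-⊆ {q = q} {r} p⊆q = ∪-⊆ (p⊆p∪q q) (q⊆p∪q r q ∘ p⊆q)

x∈p─q⇒x∉q : (p q : Subset n) {x : Fin n} → x ∈ p ─ q → x ∉ q
x∈p─q⇒x∉q (_ ∷ p) (_ ∷ q) (Vec.there x∈p─q) (Vec.there x∈q) = x∈p─q⇒x∉q p q x∈p─q x∈q
x∈p─q⇒x∉q (_ ∷ p) (_ ∷ q) ()                 Vec.here

x∈p-y⇒x≢y : {p : Subset n} {x y : Fin n} → x ∈ p - y → x ≢ y
x∈p-y⇒x≢y {p = p} {y = y} x∈p-y = x∉⁅y⁆⇒x≢y (x∈p─q⇒x∉q p ⁅ y ⁆ x∈p-y)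

x∈p-y⇒x∈p : {p : Subset n} {x y : Fin n} → x ∈ p - y → x ∈ p
x∈p-y⇒x∈p {p = p} {y = y} = p─q⊆p p ⁅ y ⁆

-‿monoˡ-⊆ : {p q : Subset n} {x : Fin n} → p ⊆ q → p - x ⊆ q - x
-‿monoˡ-⊆ p⊆q y∈p-x = x∈p∧x≢y⇒x∈p-y (p⊆q (x∈p-y⇒x∈p y∈p-x)) (x∈p-y⇒x≢y y∈p-x)

p⊆p-x∪⁅x⁆ : {p : Subset n} (x : Fin n) → p ⊆ (p - x) ∪ ⁅ x ⁆
p⊆p-x∪⁅x⁆ x {y} y∈p with y Fin.≟ x
... | yes refl = x∈p∪q⁺ (inj₂ (x∈⁅x⁆ x))
... | no  y≢x  = x∈p∪q⁺ (inj₁ (x∈p∧x≢y⇒x∈p-y y∈p y≢x))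

p-x∪⁅x⁆⊆p : {p : Subset n} {x : Fin n} → x ∈ p → (p - x) ∪ ⁅ x ⁆ ⊆ p
p-x∪⁅x⁆⊆p x∈p = ∪-⊆ x∈p-y⇒x∈p (⁅x⁆⊆p x∈p)

q⊆⁅x⁆∪p⇒q-x⊆p : {p q : Subset n} {x : Fin n} → q ⊆ ⁅ x ⁆ ∪ p → q - x ⊆ p
q⊆⁅x⁆∪p⇒q-x⊆p {p = p} {x = x} q⊆ y∈q-x with x∈p∪q⁻ ⁅ x ⁆ p (q⊆ (x∈p-y⇒x∈p y∈q-x))
... | inj₁ y∈⁅x⁆ = ⊥-elim (x∈p-y⇒x≢y y∈q-x (x∈⁅y⁆⇒x≡y x y∈⁅x⁆))
... | inj₂ y∈p   = y∈p

q⊆⁅x⁆∪p⇒q⊆p : {p q : Subset n} {x : Fin n} → q ⊆ ⁅ x ⁆ ∪ p → x ∉ q → q ⊆ p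
q⊆⁅x⁆∪p⇒q⊆p q⊆ x∉q y∈q = q⊆⁅x⁆∪p⇒q-x⊆p q⊆ (x∈p∧x≢y⇒x∈p-y y∈q λ { refl → x∉q y∈q })

∣p∣<∣⁅x⁆∪p∣ : {p : Subset n} {x : Fin n} → x ∉ p → ∣ p ∣ < ∣ ⁅ x ⁆ ∪ p ∣
∣p∣<∣⁅x⁆∪p∣ {p = p} {x} x∉p = p⊂q⇒∣p∣<∣q∣ (q⊆p∪q ⁅ x ⁆ p , x , x∈p∪q⁺ (inj₁ (x∈⁅x⁆ x)) , x∉p)

∣⁅x⁆∪p∣≤1+∣p∣ : (x : Fin n) (p : Subset n) → ∣ ⁅ x ⁆ ∪ p ∣ ≤ suc ∣ p ∣
∣⁅x⁆∪p∣≤1+∣p∣ Fin.zero    (s ∷ p)     rewrite ∪-identityˡ p = s≤s (∣p∣≤∣x∷p∣ s p)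
∣⁅x⁆∪p∣≤1+∣p∣ (Fin.suc x) (true  ∷ p) = s≤s (∣⁅x⁆∪p∣≤1+∣p∣ x p)
∣⁅x⁆∪p∣≤1+∣p∣ (Fin.suc x) (false ∷ p) = ∣⁅x⁆∪p∣≤1+∣p∣ x p

fromList : List (Fin n) → Subset n
fromList = foldr (λ x p → ⁅ x ⁆ ∪ p) Subset.⊥

∈-fromList⁺ : {x : Fin n} {xs : List (Fin n)} → x ∈ₗ xs → x ∈ fromList xs
∈-fromList⁺ (here refl)  = x∈p∪q⁺ (inj₁ (x∈⁅x⁆ _))
∈-fromList⁺ (there x∈xs) = x∈p∪q⁺ (inj₂ (∈-fromList⁺ x∈xs))

∈-fromList⁻ : {x : Fin n} (xs : List (Fin n)) → x ∈ fromList xs → x ∈ₗ xs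
∈-fromList⁻ []       x∈ = ⊥-elim (∉⊥ x∈)
∈-fromList⁻ (y ∷ ys) x∈ with x∈p∪q⁻ ⁅ y ⁆ (fromList ys) x∈
... | inj₁ x∈⁅y⁆ = here (x∈⁅y⁆⇒x≡y y x∈⁅y⁆)
... | inj₂ x∈ys  = there (∈-fromList⁻ ys x∈ys)

∣fromList∣≤length : (xs : List (Fin n)) → ∣ fromList xs ∣ ≤ length xs
∣fromList∣≤length {n} []  = ≤-reflexive (∣⊥∣≡0 n)
∣fromList∣≤length (x ∷ xs) = ≤-trans (∣⁅x⁆∪p∣≤1+∣p∣ x (fromList xs)) (s≤s (∣fromList∣≤length xs))

select : {P : Fin n → Set} → Decidable P → Subset n
select P? = tabulate (does ∘ P?)

∈-select⁺ : {P : Fin n → Set} {P? : Decidable P} {x : Fin n} → P x → x ∈ select P?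
∈-select⁺ {P? = P?} {x} px = lookup⇒[]= x _ (trans (lookup∘tabulate _ x) (dec-true (P? x) px))

∈-select⁻ : {P : Fin n → Set} {P? : Decidable P} {x : Fin n} → x ∈ select P? → P x
∈-select⁻ {P? = P?} {x} x∈ = does-true (P? x) (trans (sym (lookup∘tabulate (does ∘ P?) x)) ([]=⇒lookup x∈))
  where
  does-true : ∀ {A : Set} (a? : Dec A) → does a? ≡ true → A
  does-true (yes a) _ = a

-- Column sums and spans

colSum-∷ : (A : Fin (suc n) → Vec Bool m) (b : Bool) (Z : Subset n) →
           colSum A (b ∷ Z) ≡ b · A Fin.zero ⊕ colSum (A ∘ Fin.suc) Z
colSum-∷ A true  Z = refl
colSum-∷ A false Z = sym (⊕-identityˡ _)

colSum-⊥ : (A : Fin n → Vec Bool m) → colSum A Subset.⊥ ≡ 0ᵥ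
colSum-⊥ {zero}  A = refl
colSum-⊥ {suc n} A = colSum-⊥ (A ∘ Fin.suc)

colSum-⁅⁆ : (A : Fin n → Vec Bool m) (x : Fin n) → colSum A ⁅ x ⁆ ≡ A x
colSum-⁅⁆ A Fin.zero    = trans (cong (A Fin.zero ⊕_) (colSum-⊥ (A ∘ Fin.suc))) (⊕-identityʳ _)
colSum-⁅⁆ A (Fin.suc x) = colSum-⁅⁆ (A ∘ Fin.suc) x

colSum-⊕ : (A : Fin n → Vec Bool m) (Z Z′ : Subset n) → colSum A (Z ⊕ Z′) ≡ colSum A Z ⊕ colSum A Z′
colSum-⊕ {zero}  A []      []       = sym (⊕-self 0ᵥ)
colSum-⊕ {suc n} A (a ∷ Z) (b ∷ Z′) = begin
  colSum A ((a xor b) ∷ (Z ⊕ Z′))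
    ≡⟨ colSum-∷ A (a xor b) (Z ⊕ Z′) ⟩
  (a xor b) · A₀ ⊕ colSum A′ (Z ⊕ Z′)
    ≡⟨ cong₂ _⊕_ (·-distrib-xor a b A₀) (colSum-⊕ A′ Z Z′) ⟩
  (a · A₀ ⊕ b · A₀) ⊕ (colSum A′ Z ⊕ colSum A′ Z′)
    ≡⟨ ⊕-interchange (a · A₀) (b · A₀) (colSum A′ Z) (colSum A′ Z′) ⟩
  (a · A₀ ⊕ colSum A′ Z) ⊕ (b · A₀ ⊕ colSum A′ Z′)
    ≡⟨ sym (cong₂ _⊕_ (colSum-∷ A a Z) (colSum-∷ A b Z′)) ⟩
  colSum A (a ∷ Z) ⊕ colSum A (b ∷ Z′)
    ∎
  where
  open ≡-Reasoning
  A₀ = A Fin.zero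
  A′ = A ∘ Fin.suc

colSum-∈ : (A : Fin n → Vec Bool m) {Z : Subset n} {x : Fin n} → x ∈ Z →
           colSum A Z ≡ A x ⊕ colSum A (Z - x)
colSum-∈ A {true ∷ Z} Vec.here = cong (λ W → A Fin.zero ⊕ colSum (A ∘ Fin.suc) W) (sym (p─⊥≡p Z))
colSum-∈ A {true ∷ Z} {Fin.suc x} (Vec.there x∈Z) = begin
  A₀ ⊕ colSum A′ Z                   ≡⟨ cong (A₀ ⊕_) (colSum-∈ A′ x∈Z) ⟩
  A₀ ⊕ (A′ x ⊕ colSum A′ (Z - x))    ≡⟨ ⊕-swap A₀ (A′ x) (colSum A′ (Z - x)) ⟩
  A′ x ⊕ (A₀ ⊕ colSum A′ (Z - x))    ∎
  where
  open ≡-Reasoning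
  A₀ = A Fin.zero
  A′ = A ∘ Fin.suc
colSum-∈ A {false ∷ Z} (Vec.there x∈Z) = colSum-∈ (A ∘ Fin.suc) x∈Z

colSum-∪⁅⁆ : (A : Fin n → Vec Bool m) {Z : Subset n} {x : Fin n} → x ∉ Z →
             colSum A (⁅ x ⁆ ∪ Z) ≡ A x ⊕ colSum A Z
colSum-∪⁅⁆ A {Z} {x} x∉Z =
  trans (colSum-∈ A (x∈p∪q⁺ (inj₁ (x∈⁅x⁆ x)))) (cong (λ W → A x ⊕ colSum A W) ⁅x⁆∪Z-x≡Z)
  where
  ⁅x⁆∪Z-x≡Z : (⁅ x ⁆ ∪ Z) - x ≡ Z
  ⁅x⁆∪Z-x≡Z = ⊆-antisym (q⊆⁅x⁆∪p⇒q-x⊆p id)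
    (λ y∈Z → x∈p∧x≢y⇒x∈p-y (q⊆p∪q ⁅ x ⁆ Z y∈Z) λ { refl → x∉Z y∈Z })

sumOf : (Fin n → Vec Bool m) → List (Fin n) → Vec Bool m
sumOf A = foldr (λ x v → A x ⊕ v) 0ᵥ

colSum-fromList : (A : Fin n → Vec Bool m) {xs : List (Fin n)} → Unique xs →
                  colSum A (fromList xs) ≡ sumOf A xs
colSum-fromList A []                        = colSum-⊥ A
colSum-fromList A {x ∷ xs} (x∉xs ∷ unique) = begin
  colSum A (⁅ x ⁆ ∪ fromList xs)  ≡⟨ colSum-∪⁅⁆ A (All¬⇒¬Any x∉xs ∘ ∈-fromList⁻ xs) ⟩
  A x ⊕ colSum A (fromList xs)    ≡⟨ cong (A x ⊕_) (colSum-fromList A unique) ⟩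
  A x ⊕ sumOf A xs                ∎
  where open ≡-Reasoning

elems : (Y : Subset n) → Fin ∣ Y ∣ → Fin n
elems (true  ∷ Y) Fin.zero    = Fin.zero
elems (true  ∷ Y) (Fin.suc i) = Fin.suc (elems Y i)
elems (false ∷ Y) i           = Fin.suc (elems Y i)

coords : (Y : Subset n) → Subset n → Subset ∣ Y ∣
coords []          []      = []
coords (true  ∷ Y) (b ∷ Z) = b ∷ coords Y Z
coords (false ∷ Y) (_ ∷ Z) = coords Y Z

colSum-coords : (A : Fin n → Vec Bool m) {Y Z : Subset n} → Z ⊆ Y →
                colSum (A ∘ elems Y) (coords Y Z) ≡ colSum A Z
colSum-coords A {[]}        {[]}        _   = refl
colSum-coords A {true  ∷ Y} {true  ∷ Z} Z⊆Y = cong (A Fin.zero ⊕_) (colSum-coords (A ∘ Fin.suc) (drop-∷-⊆ Z⊆Y))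
colSum-coords A {true  ∷ Y} {false ∷ Z} Z⊆Y = colSum-coords (A ∘ Fin.suc) (drop-∷-⊆ Z⊆Y)
colSum-coords A {false ∷ Y} {false ∷ Z} Z⊆Y = colSum-coords (A ∘ Fin.suc) (drop-∷-⊆ Z⊆Y)
colSum-coords A {false ∷ Y} {true  ∷ Z} Z⊆Y with () ← Z⊆Y Vec.here

InSpan : (Fin n → Vec Bool m) → Subset n → Vec Bool m → Set
InSpan A Y v = ∃ λ Z → Z ⊆ Y × colSum A Z ≡ v

InSpan? : (A : Fin n → Vec Bool m) (Y : Subset n) (v : Vec Bool m) → Dec (InSpan A Y v)
InSpan? A Y v = anySubset? (λ Z → (Z ⊆? Y) ×-dec ≡-dec _≟ᵇ_ (colSum A Z) v)

module _ (A : Fin n → Vec Bool m) where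

  InSpan-⊥ : ∀ {v} → InSpan A Subset.⊥ v → v ≡ 0ᵥ
  InSpan-⊥ (Z , Z⊆⊥ , refl) = trans (cong (colSum A) (⊆-antisym Z⊆⊥ ⊥⊆)) (colSum-⊥ A)

  InSpan-∪⁅⁆ : ∀ {Y e v} → InSpan A (⁅ e ⁆ ∪ Y) v → InSpan A Y v ⊎ InSpan A Y (A e ⊕ v)
  InSpan-∪⁅⁆ {e = e} (Z , Z⊆ , refl) with e ∈? Z
  ... | yes e∈Z =
    inj₂ (Z - e , q⊆⁅x⁆∪p⇒q-x⊆p Z⊆ , sym (trans (cong (A e ⊕_) (colSum-∈ A e∈Z)) (⊕-cancelˡ (A e) _)))
  ... | no  e∉Z = inj₁ (Z , q⊆⁅x⁆∪p⇒q⊆p Z⊆ e∉Z , refl)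

  InSpan-pair : ∀ {a b v} → InSpan A (fromList (a ∷ b ∷ [])) v →
                v ≡ 0ᵥ ⊎ v ≡ A b ⊎ v ≡ A a ⊎ v ≡ A a ⊕ A b
  InSpan-pair {a} {b} {v} inSpan with InSpan-∪⁅⁆ inSpan
  ... | inj₁ inSpan₁ with InSpan-∪⁅⁆ inSpan₁
  ...   | inj₁ inSpan₀ = inj₁ (InSpan-⊥ inSpan₀)
  ...   | inj₂ inSpan₀ = inj₂ (inj₁ (sym (⊕≡0⇒≡ (InSpan-⊥ inSpan₀))))
  InSpan-pair {a} {b} {v} inSpan | inj₂ inSpan₁ with InSpan-∪⁅⁆ inSpan₁
  ...   | inj₁ inSpan₀ = inj₂ (inj₂ (inj₁ (sym (⊕≡0⇒≡ (InSpan-⊥ inSpan₀)))))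
  ...   | inj₂ inSpan₀ = inj₂ (inj₂ (inj₂ (begin
    v                  ≡⟨ sym (⊕-cancelˡ (A a) v) ⟩
    A a ⊕ (A a ⊕ v)    ≡⟨ cong (A a ⊕_) (sym (⊕≡0⇒≡ (InSpan-⊥ inSpan₀))) ⟩
    A a ⊕ A b          ∎)))
    where open ≡-Reasoning

  LinIndep-∪⁅⁆ : ∀ {Y e} → LinIndep A Y → ¬ InSpan A Y (A e) → LinIndep A (⁅ e ⁆ ∪ Y)
  LinIndep-∪⁅⁆ {e = e} indep ∉span Z Z⊆ nonempty sum≡0 with e ∈? Z
  ... | yes e∈Z = ∉span (Z - e , q⊆⁅x⁆∪p⇒q-x⊆p Z⊆ , sym (⊕≡0⇒≡ (trans (sym (colSum-∈ A e∈Z)) sum≡0)))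
  ... | no  e∉Z = indep Z (q⊆⁅x⁆∪p⇒q⊆p Z⊆ e∉Z) nonempty sum≡0

  ¬InSpan⇒∣∣< : ∀ {Y e} → ¬ InSpan A Y (A e) → ∣ Y ∣ < ∣ ⁅ e ⁆ ∪ Y ∣
  ¬InSpan⇒∣∣< {e = e} ∉span = ∣p∣<∣⁅x⁆∪p∣ (λ e∈Y → ∉span (⁅ e ⁆ , ⁅x⁆⊆p e∈Y , colSum-⁅⁆ A e))

-- Rank, closure and cyclic sets

module _ (M : Matroid n) where

  ρ-mono : ∀ {X Y} → X ⊆ Y → ρ M X ≤ ρ M Y
  ρ-mono = monotone M _ _

  ρ-cong : ∀ {X Y} → X ⊆ Y → Y ⊆ X → ρ M X ≡ ρ M Y
  ρ-cong X⊆Y Y⊆X = cong (ρ M) (⊆-antisym X⊆Y Y⊆X)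

  ρ-⊥ : ρ M Subset.⊥ ≡ 0
  ρ-⊥ = n≤0⇒n≡0 (≤-trans (bounded M _) (≤-reflexive (∣⊥∣≡0 n)))

  ρ<⇒⊂ : ∀ {X Y} → X ⊆ Y → ρ M X < ρ M Y → X ⊂ Y
  ρ<⇒⊂ {X} {Y} X⊆Y ρX<ρY with any? (λ e → (e ∈? Y) ×-dec ¬? (e ∈? X))
  ... | yes (e , e∈Y , e∉X) = X⊆Y , e , e∈Y , e∉X
  ... | no  none            = ⊥-elim (<⇒≱ ρX<ρY (ρ-mono Y⊆X))
    where
    Y⊆X : Y ⊆ X
    Y⊆X {e} e∈Y with e ∈? X
    ... | yes e∈X = e∈X
    ... | no  e∉X = ⊥-elim (none (e , e∈Y , e∉X))

  ρ-∪-⊆ : ∀ {X W Y} → X ⊆ W → ρ M (X ∪ Y) ≡ ρ M X → ρ M (W ∪ Y) ≡ ρ M W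
  ρ-∪-⊆ {X} {W} {Y} X⊆W X∪Y≡X = ≤-antisym (+-cancelʳ-≤ (ρ M X) _ _ (begin
      ρ M (W ∪ Y) + ρ M X                    ≤⟨ +-mono-≤ (ρ-mono (∪-monoʳ-⊆ (q⊆p∪q X Y)))
                                                        (ρ-mono (λ x∈X → x∈p∩q⁺ (X⊆W x∈X , p⊆p∪q Y x∈X))) ⟩
      ρ M (W ∪ (X ∪ Y)) + ρ M (W ∩ (X ∪ Y))  ≤⟨ submodular M W (X ∪ Y) ⟩
      ρ M W + ρ M (X ∪ Y)                    ≡⟨ cong (ρ M W +_) X∪Y≡X ⟩
      ρ M W + ρ M X                          ∎))
    (ρ-mono (p⊆p∪q Y))
    where open ≤-Reasoning

  spans? : ∀ X e → Dec (ρ M (X ∪ ⁅ e ⁆) ≡ ρ M X)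
  spans? X e = ρ M (X ∪ ⁅ e ⁆) ℕ.≟ ρ M X

  cl : Subset n → Subset n
  cl X = select (spans? X)

  ∈cl⁺ : ∀ {X e} → ρ M (X ∪ ⁅ e ⁆) ≡ ρ M X → e ∈ cl X
  ∈cl⁺ {X} = ∈-select⁺ {P? = spans? X}

  ∈cl⁻ : ∀ {X e} → e ∈ cl X → ρ M (X ∪ ⁅ e ⁆) ≡ ρ M X
  ∈cl⁻ {X} = ∈-select⁻ {P? = spans? X}

  ⊆cl : ∀ {X} → X ⊆ cl X
  ⊆cl e∈X = ∈cl⁺ (ρ-cong (∪-⊆ id (⁅x⁆⊆p e∈X)) (p⊆p∪q _))

  cl-mono : ∀ {X W} → X ⊆ W → cl X ⊆ cl W
  cl-mono X⊆W e∈clX = ∈cl⁺ (ρ-∪-⊆ X⊆W (∈cl⁻ e∈clX))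

  ρ-∪-cl : ∀ {X} Y → Y ⊆ cl X → ρ M (X ∪ Y) ≡ ρ M X
  ρ-∪-cl {X} Y = go Y (⊂-wellFounded Y)
    where
    go : ∀ Y → Acc _⊂_ Y → Y ⊆ cl X → ρ M (X ∪ Y) ≡ ρ M X
    go Y (acc smaller) Y⊆clX with nonempty? Y
    ... | no  empty     = cong (ρ M) (trans (cong (X ∪_) (Empty-unique empty)) (∪-identityʳ X))
    ... | yes (e , e∈Y) = ≤-antisym (begin
      ρ M (X ∪ Y)                  ≤⟨ ρ-mono (∪-monoʳ-⊆ (p⊆p-x∪⁅x⁆ e)) ⟩
      ρ M (X ∪ ((Y - e) ∪ ⁅ e ⁆))  ≡⟨ cong (ρ M) (sym (∪-assoc X (Y - e) ⁅ e ⁆)) ⟩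
      ρ M ((X ∪ (Y - e)) ∪ ⁅ e ⁆)  ≡⟨ ρ-∪-⊆ (p⊆p∪q (Y - e)) (∈cl⁻ (Y⊆clX e∈Y)) ⟩
      ρ M (X ∪ (Y - e))            ≡⟨ go (Y - e) (smaller (x∈p⇒p-x⊂p e∈Y)) (Y⊆clX ∘ x∈p-y⇒x∈p) ⟩
      ρ M X                        ∎) (ρ-mono (p⊆p∪q Y))
      where open ≤-Reasoning

  ρ-cl : ∀ X → ρ M (cl X) ≡ ρ M X
  ρ-cl X = ≤-antisym (≤-trans (ρ-mono (q⊆p∪q X (cl X))) (≤-reflexive (ρ-∪-cl (cl X) id))) (ρ-mono ⊆cl)

  cl-closed : ∀ X → Closed M (cl X)
  cl-closed X e clX∪e≡clX = ∈cl⁺ (≤-antisym (begin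
      ρ M (X ∪ ⁅ e ⁆)      ≤⟨ ρ-mono (∪-monoˡ-⊆ ⊆cl) ⟩
      ρ M (cl X ∪ ⁅ e ⁆)   ≡⟨ clX∪e≡clX ⟩
      ρ M (cl X)           ≡⟨ ρ-cl X ⟩
      ρ M X                ∎) (ρ-mono (p⊆p∪q ⁅ e ⁆)))
    where open ≤-Reasoning

  cyclic⇒∈cl : ∀ {X e} → Cyclic M X → e ∈ X → e ∈ cl (X - e)
  cyclic⇒∈cl {e = e} cyclic e∈X = ∈cl⁺ (trans (ρ-cong (p-x∪⁅x⁆⊆p e∈X) (p⊆p-x∪⁅x⁆ e)) (sym (cyclic e e∈X)))

  ∈cl⇒cyclic : ∀ {X} → (∀ {e} → e ∈ X → e ∈ cl (X - e)) → Cyclic M X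
  ∈cl⇒cyclic {X} spanned e e∈X = ≤-antisym (ρ-mono x∈p-y⇒x∈p) (begin
      ρ M X                 ≤⟨ ρ-mono (p⊆p-x∪⁅x⁆ e) ⟩
      ρ M ((X - e) ∪ ⁅ e ⁆) ≡⟨ ∈cl⁻ (spanned e∈X) ⟩
      ρ M (X - e)           ∎)
    where open ≤-Reasoning

  Cyclic-∪ : ∀ {X Y} → Cyclic M X → Cyclic M Y → Cyclic M (X ∪ Y)
  Cyclic-∪ {X} {Y} cyclicX cyclicY = ∈cl⇒cyclic λ e∈X∪Y → [
      (λ e∈X → cl-mono (-‿monoˡ-⊆ (p⊆p∪q Y)) (cyclic⇒∈cl cyclicX e∈X)) ,
      (λ e∈Y → cl-mono (-‿monoˡ-⊆ (q⊆p∪q X Y)) (cyclic⇒∈cl cyclicY e∈Y)) ]′ (x∈p∪q⁻ X Y e∈X∪Y)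

  Cyclic-cl : ∀ {X} → Cyclic M X → Cyclic M (cl X)
  Cyclic-cl {X} cyclicX = ∈cl⇒cyclic spanned
    where
    spanned : ∀ {e} → e ∈ cl X → e ∈ cl (cl X - e)
    spanned {e} e∈clX with e ∈? X
    ... | yes e∈X = cl-mono (-‿monoˡ-⊆ ⊆cl) (cyclic⇒∈cl cyclicX e∈X)
    ... | no  e∉X = cl-mono (λ x∈X → x∈p∧x≢y⇒x∈p-y (⊆cl x∈X) λ { refl → e∉X x∈X }) e∈clX

  ⊥-cyclicFlat : (∀ e → ¬ Loop M e) → CyclicFlat M Subset.⊥
  ⊥-cyclicFlat no-loop = closed , λ _ e∈⊥ → ⊥-elim (∉⊥ e∈⊥)
    where
    closed : Closed M Subset.⊥
    closed e ⊥∪e≡⊥ = ⊥-elim (no-loop e (trans (cong (ρ M) (sym (∪-identityˡ ⁅ e ⁆))) (trans ⊥∪e≡⊥ ρ-⊥)))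

  ⊤-cyclicFlat : (∀ e → ¬ Isthmus M e) → CyclicFlat M ⊤
  ⊤-cyclicFlat no-isthmus = (λ _ _ → ∈⊤) , λ e _ → ≤-antisym (ρ-mono ⊆⊤) (≮⇒≥ (no-isthmus e))

-- Binary matroids

module _ (M : Matroid n) (A : Fin n → Vec Bool m) (rep : ∀ X → IsF₂Rank A X (ρ M X)) where

  LinIndep⇒∣∣≤ρ : ∀ {X Y} → Y ⊆ X → LinIndep A Y → ∣ Y ∣ ≤ ρ M X
  LinIndep⇒∣∣≤ρ {X} {Y} = proj₂ (rep X) Y

  dependent⇒ρ< : ∀ {X Z} → Z ⊆ X → Nonempty Z → colSum A Z ≡ 0ᵥ → ρ M X < ∣ X ∣
  dependent⇒ρ< {X} {Z} Z⊆X nonempty sum≡0 with proj₁ (rep X)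
  ... | Y , Y⊆X , indepY , ∣Y∣≡ρX = ≤∧≢⇒< (bounded M X) ρX≢∣X∣
    where
    ρX≢∣X∣ : ρ M X ≢ ∣ X ∣
    ρX≢∣X∣ ρX≡∣X∣ = indepY Z (X⊆Y ∘ Z⊆X) nonempty sum≡0
      where
      X⊆Y : X ⊆ Y
      X⊆Y {e} e∈X with e ∈? Y
      ... | yes e∈Y = e∈Y
      ... | no  e∉Y = ⊥-elim (<-irrefl (trans ∣Y∣≡ρX ρX≡∣X∣) (p⊂q⇒∣p∣<∣q∣ (Y⊆X , e , e∈X , e∉Y)))

  -- Every column is a sum of columns of the basis Y of E, since otherwise Y could be
  -- extended to an independent set larger than ρ E.
  coordinates : ∀ {d} → ρ M ⊤ ≡ d → Σ (Fin d → Vec Bool m) λ B → ∀ e → ∃ λ c → colSum B c ≡ A e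
  coordinates ρ⊤≡d with proj₁ (rep ⊤)
  ... | Y , _ , indepY , ∣Y∣≡ρ⊤ =
    subst (λ d → Σ (Fin d → Vec Bool m) λ B → ∀ e → ∃ λ c → colSum B c ≡ A e)
          (trans ∣Y∣≡ρ⊤ ρ⊤≡d) (A ∘ elems Y , code)
    where
    spanned : ∀ e → InSpan A Y (A e)
    spanned e with InSpan? A Y (A e)
    ... | yes inSpan = inSpan
    ... | no  ∉span  = ⊥-elim (<⇒≱ (¬InSpan⇒∣∣< A ∉span) (begin
      ∣ ⁅ e ⁆ ∪ Y ∣  ≤⟨ LinIndep⇒∣∣≤ρ ⊆⊤ (LinIndep-∪⁅⁆ A indepY ∉span) ⟩
      ρ M ⊤          ≡⟨ sym ∣Y∣≡ρ⊤ ⟩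
      ∣ Y ∣          ∎))
      where open ≤-Reasoning
    code : ∀ e → ∃ λ c → colSum (A ∘ elems Y) c ≡ A e
    code e with spanned e
    ... | Z , Z⊆Y , sum≡Ae = coords Y Z , trans (colSum-coords A Z⊆Y) sum≡Ae

  module _ (simple : Simple M) where

    1≤ρ⁅⁆ : ∀ e → 1 ≤ ρ M ⁅ e ⁆
    1≤ρ⁅⁆ e = n≢0⇒n>0 (proj₁ simple e)

    2≤ρ : ∀ {a b X} → a ≢ b → a ∈ X → b ∈ X → 2 ≤ ρ M X
    2≤ρ {a} {b} a≢b a∈X b∈X = ≤-trans
      (≤∧≢⇒< (≤-trans (1≤ρ⁅⁆ a) (ρ-mono M (p⊆p∪q ⁅ b ⁆)))
             (λ 1≡ρ → proj₂ simple a b (a≢b , proj₁ simple a , proj₁ simple b , sym 1≡ρ)))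
      (ρ-mono M (∪-⊆ (⁅x⁆⊆p a∈X) (⁅x⁆⊆p b∈X)))

    A-nonzero : ∀ e → A e ≢ 0ᵥ
    A-nonzero e Ae≡0 = <⇒≱
      (subst (ρ M ⁅ e ⁆ <_) (∣⁅x⁆∣≡1 e) (dependent⇒ρ< id (e , x∈⁅x⁆ e) (trans (colSum-⁅⁆ A e) Ae≡0)))
      (1≤ρ⁅⁆ e)

    A-injective : Injective _≡_ _≡_ A
    A-injective {a} {b} Aa≡Ab with a Fin.≟ b
    ... | yes a≡b = a≡b
    ... | no  a≢b = ⊥-elim (<⇒≱
      (≤-trans (dependent⇒ρ< id (a , ∈pair (here refl)) pair-sum) (∣fromList∣≤length (a ∷ b ∷ [])))
      (2≤ρ a≢b (∈pair (here refl)) (∈pair (there (here refl)))))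
      where
      ∈pair : ∀ {x} → x ∈ₗ a ∷ b ∷ [] → x ∈ fromList (a ∷ b ∷ [])
      ∈pair = ∈-fromList⁺
      pair-sum : colSum A (fromList (a ∷ b ∷ [])) ≡ 0ᵥ
      pair-sum = begin
        colSum A (fromList (a ∷ b ∷ []))  ≡⟨ colSum-fromList A ((a≢b ∷ []) ∷ [] ∷ []) ⟩
        A a ⊕ (A b ⊕ 0ᵥ)                  ≡⟨ cong₂ _⊕_ Aa≡Ab (⊕-identityʳ (A b)) ⟩
        A b ⊕ A b                         ≡⟨ ⊕-self (A b) ⟩
        0ᵥ                                ∎
        where open ≡-Reasoning

    A-points : PointSet n m
    A-points = record { point = A ; point-injective = A-injective ; point-nonzero = A-nonzero }

    coordinate-points : ∀ {d} → ρ M ⊤ ≡ d →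
      Σ (Fin d → Vec Bool m) λ B → Σ (PointSet n d) λ S → ∀ e → colSum B (PointSet.point S e) ≡ A e
    coordinate-points ρ⊤≡d with coordinates ρ⊤≡d
    ... | B , code = B , points , proj₂ ∘ code
      where
      open ≡-Reasoning
      points : PointSet n _
      points = record
        { point           = proj₁ ∘ code
        ; point-injective = λ {a} {b} ca≡cb → A-injective (begin
            A a                        ≡⟨ sym (proj₂ (code a)) ⟩
            colSum B (proj₁ (code a))  ≡⟨ cong (colSum B) ca≡cb ⟩
            colSum B (proj₁ (code b))  ≡⟨ proj₂ (code b) ⟩
            A b                        ∎)
        ; point-nonzero   = λ e ce≡0 → A-nonzero e (begin
            A e                        ≡⟨ sym (proj₂ (code e)) ⟩
            colSum B (proj₁ (code e))  ≡⟨ cong (colSum B) ce≡0 ⟩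
            colSum B 0ᵥ                ≡⟨ colSum-⊥ B ⟩
            0ᵥ                         ∎)
        }

    ρ-triangle : ∀ {a b c} → A a ⊕ A b ≡ A c → ρ M (fromList (a ∷ b ∷ c ∷ [])) ≡ 2
    ρ-triangle {a} {b} {c} line with line-distinct A-points line
    ... | a≢b , a≢c , b≢c = ≤-antisym
      (≤-pred (≤-trans (dependent⇒ρ< id (a , ∈T (here refl)) triangle-sum) (∣fromList∣≤length T)))
      (2≤ρ a≢b (∈T (here refl)) (∈T (there (here refl))))
      where
      T = a ∷ b ∷ c ∷ []
      ∈T : ∀ {x} → x ∈ₗ T → x ∈ fromList T
      ∈T = ∈-fromList⁺
      triangle-sum : colSum A (fromList T) ≡ 0ᵥ
      triangle-sum = begin
        colSum A (fromList T)     ≡⟨ colSum-fromList A ((a≢b ∷ a≢c ∷ []) ∷ (b≢c ∷ []) ∷ [] ∷ []) ⟩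
        A a ⊕ (A b ⊕ (A c ⊕ 0ᵥ))  ≡⟨ cong (λ x → A a ⊕ (A b ⊕ x)) (⊕-identityʳ (A c)) ⟩
        A a ⊕ (A b ⊕ A c)         ≡⟨ sym (⊕-assoc (A a) (A b) (A c)) ⟩
        (A a ⊕ A b) ⊕ A c         ≡⟨ cong (_⊕ A c) line ⟩
        A c ⊕ A c                 ≡⟨ ⊕-self (A c) ⟩
        0ᵥ                        ∎
        where open ≡-Reasoning

    triangle-cyclic : ∀ {a b c} → A a ⊕ A b ≡ A c → Cyclic M (fromList (a ∷ b ∷ c ∷ []))
    triangle-cyclic {a} {b} {c} line e e∈T with line-distinct A-points line
    ... | a≢b , a≢c , b≢c = ≤-antisym (ρ-mono M x∈p-y⇒x∈p)
      (≤-trans (≤-reflexive (ρ-triangle line)) (two-left (∈-fromList⁻ T e∈T)))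
      where
      T = a ∷ b ∷ c ∷ []
      keep : ∀ {x} → x ∈ₗ T → x ≢ e → x ∈ fromList T - e
      keep x∈T x≢e = x∈p∧x≢y⇒x∈p-y (∈-fromList⁺ x∈T) x≢e
      two-left : e ∈ₗ T → 2 ≤ ρ M (fromList T - e)
      two-left (here refl)                 =
        2≤ρ b≢c (keep (there (here refl)) (≢-sym a≢b)) (keep (there (there (here refl))) (≢-sym a≢c))
      two-left (there (here refl))         =
        2≤ρ a≢c (keep (here refl) a≢b) (keep (there (there (here refl))) (≢-sym b≢c))
      two-left (there (there (here refl))) =
        2≤ρ a≢b (keep (here refl) a≢c) (keep (there (here refl)) b≢c)

    3≤ρ : ∀ {p q w u X} → A p ⊕ A q ≡ A w → u ∉ₗ p ∷ q ∷ w ∷ [] → u ∈ X → p ∈ X → q ∈ X → 3 ≤ ρ M X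
    3≤ρ {p} {q} {w} {u} {X} line u∉ℓ u∈X p∈X q∈X = ≤-trans size (LinIndep⇒∣∣≤ρ Y⊆X indep)
      where
      q∉span : ¬ InSpan A Subset.⊥ (A q)
      q∉span = A-nonzero q ∘ InSpan-⊥ A
      p∉span : ¬ InSpan A (fromList (q ∷ [])) (A p)
      p∉span inSpan with InSpan-∪⁅⁆ A inSpan
      ... | inj₁ inSpan₀ = A-nonzero p (InSpan-⊥ A inSpan₀)
      ... | inj₂ inSpan₀ =
        proj₁ (line-distinct A-points line) (sym (A-injective (⊕≡0⇒≡ (InSpan-⊥ A inSpan₀))))
      u∉span : ¬ InSpan A (fromList (p ∷ q ∷ [])) (A u)
      u∉span inSpan with InSpan-pair A inSpan
      ... | inj₁ Au≡0                   = A-nonzero u Au≡0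
      ... | inj₂ (inj₁ Au≡Aq)           = u∉ℓ (there (here (A-injective Au≡Aq)))
      ... | inj₂ (inj₂ (inj₁ Au≡Ap))    = u∉ℓ (here (A-injective Au≡Ap))
      ... | inj₂ (inj₂ (inj₂ Au≡Ap⊕Aq)) = u∉ℓ (there (there (here (A-injective (trans Au≡Ap⊕Aq line)))))
      indep : LinIndep A (fromList (u ∷ p ∷ q ∷ []))
      indep = LinIndep-∪⁅⁆ A (LinIndep-∪⁅⁆ A (LinIndep-∪⁅⁆ A indep-∅ q∉span) p∉span) u∉span
        where
        indep-∅ : LinIndep A Subset.⊥
        indep-∅ Z Z⊆⊥ (f , f∈Z) _ = ∉⊥ (Z⊆⊥ f∈Z)
      size : 3 ≤ ∣ fromList (u ∷ p ∷ q ∷ []) ∣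
      size = begin
        3                                   ≤⟨ s≤s (s≤s (s≤s z≤n)) ⟩
        suc (suc (suc ∣ Subset.⊥ {n} ∣))    ≤⟨ s≤s (s≤s (¬InSpan⇒∣∣< A q∉span)) ⟩
        suc (suc ∣ fromList (q ∷ []) ∣)     ≤⟨ s≤s (¬InSpan⇒∣∣< A p∉span) ⟩
        suc ∣ fromList (p ∷ q ∷ []) ∣       ≤⟨ ¬InSpan⇒∣∣< A u∉span ⟩
        ∣ fromList (u ∷ p ∷ q ∷ []) ∣       ∎
        where open ≤-Reasoning
      Y⊆X : fromList (u ∷ p ∷ q ∷ []) ⊆ X
      Y⊆X = ∪-⊆ (⁅x⁆⊆p u∈X) (∪-⊆ (⁅x⁆⊆p p∈X) (∪-⊆ (⁅x⁆⊆p q∈X) ⊥⊆))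

    meeting-lines⇒¬Height3 : MeetingLines A → (∀ e → ¬ Isthmus M e) → ρ M ⊤ ≡ 4 → ¬ Height3 M
    meeting-lines⇒¬Height3 L no-isthmus ρ⊤≡4 (_ , no-4-chain) = no-4-chain Subset.⊥ Z₁ Z₂ ⊤
      (⊥-cyclicFlat M (proj₁ simple))
      (cl-closed M T₁ , Cyclic-cl M (triangle-cyclic line₁))
      (cl-closed M (T₁ ∪ T₂) , Cyclic-cl M (Cyclic-∪ M (triangle-cyclic line₁) (triangle-cyclic line₂)))
      (⊤-cyclicFlat M no-isthmus)
      (ρ<⇒⊂ M ⊥⊆                     (subst₂ _<_ (sym (ρ-⊥ M)) (sym ρZ₁) (s≤s z≤n)))
      (ρ<⇒⊂ M (cl-mono M (p⊆p∪q T₂)) (subst₂ _<_ (sym ρZ₁) (sym ρZ₂) ≤-refl))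
      (ρ<⇒⊂ M ⊆⊤                     (subst₂ _<_ (sym ρZ₂) (sym ρ⊤≡4) ≤-refl))
      where
      open MeetingLines L
      T₁ = fromList (p ∷ q ∷ w ∷ [])
      T₂ = fromList (u ∷ v ∷ s ∷ [])
      Z₁ = cl M T₁
      Z₂ = cl M (T₁ ∪ T₂)
      ∈T₁ : ∀ {x} → x ∈ₗ p ∷ q ∷ w ∷ [] → x ∈ T₁
      ∈T₁ = ∈-fromList⁺
      ∈T₂ : ∀ {x} → x ∈ₗ u ∷ v ∷ s ∷ [] → x ∈ T₂
      ∈T₂ = ∈-fromList⁺
      ρZ₁ : ρ M Z₁ ≡ 2
      ρZ₁ = trans (ρ-cl M T₁) (ρ-triangle line₁)
      ρT₁∪T₂≤3 : ρ M (T₁ ∪ T₂) ≤ 3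
      ρT₁∪T₂≤3 = +-cancelʳ-≤ 1 _ 3 (begin
        ρ M (T₁ ∪ T₂) + 1              ≤⟨ +-monoʳ-≤ (ρ M (T₁ ∪ T₂)) 1≤ρT₁∩T₂ ⟩
        ρ M (T₁ ∪ T₂) + ρ M (T₁ ∩ T₂)  ≤⟨ submodular M T₁ T₂ ⟩
        ρ M T₁ + ρ M T₂                ≡⟨ cong₂ _+_ (ρ-triangle line₁) (ρ-triangle line₂) ⟩
        4                              ∎)
        where
        open ≤-Reasoning
        1≤ρT₁∩T₂ : 1 ≤ ρ M (T₁ ∩ T₂)
        1≤ρT₁∩T₂ = ≤-trans (1≤ρ⁅⁆ s) (ρ-mono M (⁅x⁆⊆p (x∈p∩q⁺ (∈T₁ s∈line₁ , ∈T₂ (there (there (here refl)))))))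
      ρZ₂ : ρ M Z₂ ≡ 3
      ρZ₂ = trans (ρ-cl M (T₁ ∪ T₂)) (≤-antisym ρT₁∪T₂≤3 (3≤ρ line₁ u∉line₁
        (q⊆p∪q T₁ T₂ (∈T₂ (here refl)))
        (p⊆p∪q T₂ (∈T₁ (here refl)))
        (p⊆p∪q T₂ (∈T₁ (there (here refl))))))

proposition8p7 : (n : ℕ) (M : Matroid n) → Binary M → Simple M →
    (∀ e → ¬ Isthmus M e) → ρ M ⊤ ≡ 4 → Height3 M → n ≤ 8
proposition8p7 n M (m , A , rep) simple no-isthmus ρ⊤≡4 height3 with 9 ℕ.≤? n
... | no  n≱9 = ≤-pred (≰⇒> n≱9)
... | yes n≥9 with coordinate-points M A rep simple ρ⊤≡4
...   | B , points , B-coordinates =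
  ⊥-elim (meeting-lines⇒¬Height3 M A rep simple lines no-isthmus ρ⊤≡4 height3)
  where
  lines : MeetingLines A
  lines = MeetingLines-map (colSum B) (colSum-⊕ B) B-coordinates
            (meeting-lines points n≥9 (≤-trans (n≤1+n 8) n≥9))
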